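{- Let $\mathbf L=(L,\vee,\wedge,0,1)$ be a complemented modular lattice and $a,b\in L$. Then: (i) $a\wedge(a\to b)=\{a\wedge b\}$, and $a\wedge b\le b$ (Modus Ponens); (ii) if $a^+\le b^+$ then $(a\to b)\wedge b^+=a^+$ (Modus Tollens); (iii) if $c\in a\to b$ then $a\to c=a\to b$; (iv) $a\to(a\to b)=a\to b$; (v) if $a^+\le b$ then $a\to b=\{b\}$.
   Context: A bounded lattice is complemented if every element $a$ has some $b$ with $a\vee b=1$, $a\wedge b=0$ (complements need not be unique); lattices are non-trivial. For $a\in L$, $a^+:=\{x\in L\mid a\vee x=1,\ a\wedge x=0\}$. For $A,B\subseteq L$: $A\vee B:=\{x\vee y\mid x\in A,y\in B\}$, $A\wedge B:=\{x\wedge y\mid x\in A,y\in B\}$, and $A\le B$ means $x\le y$ for all $x\in A$, $y\in B$; singletons are identified with elements. Define $a\to b:=a^+\vee(a\wedge b)$ and, for $B\subseteq L$, $a\to B:=a^+\vee(a\wedge B)$. -}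

module Defs where

open import Level using (Level; _⊔_; suc)
open import Data.Product using (Σ; ∃; ∃-syntax; _×_; _,_)
open import Relation.Nullary using (¬_)
open import Algebra.Lattice.Bundles using (Lattice)

record ComplementedModularLattice (c ℓ : Level) : Set (suc (c ⊔ ℓ)) where
  field
    lattice : Lattice c ℓ
  open Lattice lattice public
  _≤_ : Carrier → Carrier → Set ℓ
  x ≤ y = (x ∧ y) ≈ x
  field
    𝟎 𝟏        : Carrier
    𝟎-least    : ∀ x → 𝟎 ≤ x
    𝟏-greatest : ∀ x → x ≤ 𝟏
    modular    : ∀ x y z → x ≤ z → (x ∨ (y ∧ z)) ≈ ((x ∨ y) ∧ z)
    nontrivial : ¬ (𝟎 ≈ 𝟏)
    complemented : ∀ a → ∃[ b ] (((a ∨ b) ≈ 𝟏) × ((a ∧ b) ≈ 𝟎))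

module Subsets {c ℓ : Level} (L : ComplementedModularLattice c ℓ) where
  open ComplementedModularLattice L

  Subset : Set (suc (c ⊔ ℓ))
  Subset = Carrier → Set (c ⊔ ℓ)

  _∈_ : Carrier → Subset → Set (c ⊔ ℓ)
  x ∈ A = A x

  ⟦_⟧ : Carrier → Subset
  ⟦ a ⟧ x = Level.Lift (c ⊔ ℓ) (x ≈ a)

  _≐_ : Subset → Subset → Set (c ⊔ ℓ)
  A ≐ B = (∀ x → x ∈ A → x ∈ B) × (∀ x → x ∈ B → x ∈ A)

  _⁺ : Carrier → Subset
  (a ⁺) x = Level.Lift (c ⊔ ℓ) (((a ∨ x) ≈ 𝟏) × ((a ∧ x) ≈ 𝟎))

  _∨ˢ_ : Subset → Subset → Subset
  (A ∨ˢ B) z = ∃[ x ] ∃[ y ] (x ∈ A × y ∈ B × Level.Lift c (z ≈ (x ∨ y)))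

  _∧ˢ_ : Subset → Subset → Subset
  (A ∧ˢ B) z = ∃[ x ] ∃[ y ] (x ∈ A × y ∈ B × Level.Lift c (z ≈ (x ∧ y)))

  _≤ˢ_ : Subset → Subset → Set (c ⊔ ℓ)
  A ≤ˢ B = ∀ x y → x ∈ A → y ∈ B → x ≤ y

  _⇒_ : Carrier → Carrier → Subset
  a ⇒ b = (a ⁺) ∨ˢ ⟦ a ∧ b ⟧

  -- a → B := a⁺ ∨ (a ∧ B)   (a identified with {a})
  _⇒ˢ_ : Carrier → Subset → Subset
  a ⇒ˢ B = (a ⁺) ∨ˢ (⟦ a ⟧ ∧ˢ B)

-- The modular law turns a join with an element disjoint from the upper
-- bound into a cancellation: if x ≤ y and z ∧ y = 0 then (x ∨ z) ∧ y = x.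
-- With y = a and z a complement of a this says that every element of a → b
-- meets a in exactly a ∧ b, which gives (i), and since a → b depends on b
-- only through a ∧ b also (iii) and (iv).  With y ∈ b⁺ it gives (ii), and
-- the dual cancellation x ≤ y, x ∨ z = 1 ⟹ x ∨ (z ∧ y) = y gives (v).
module Submission where

open import Defs
open import Level using (Level; lift; lower)
open import Data.Product using (_×_; _,_; proj₁; proj₂; ∃-syntax)
open import Relation.Binary.Lattice using (MeetSemilattice)
import Algebra.Lattice.Properties.Lattice as LatticeProperties
import Relation.Binary.Reasoning.Setoid as SetoidReasoning

module ComplementedModularLatticeProperties
  {c ℓ : Level} (L : ComplementedModularLattice c ℓ) where

  open ComplementedModularLattice L
  open SetoidReasoning setoid

  -- The library orders a lattice by x ≈ x ∧ y, the symmetric form of _≤_.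
  module NaturalOrder =
    MeetSemilattice (LatticeProperties.∧-orderTheoreticMeetSemilattice lattice)

  x∧y≤x : ∀ x y → (x ∧ y) ≤ x
  x∧y≤x x y = sym (NaturalOrder.x∧y≤x x y)

  x∧y≤y : ∀ x y → (x ∧ y) ≤ y
  x∧y≤y x y = sym (NaturalOrder.x∧y≤y x y)

  ∧-zeroʳ : ∀ x → (x ∧ 𝟎) ≈ 𝟎
  ∧-zeroʳ x = trans (∧-comm x 𝟎) (𝟎-least x)

  ∨-identityʳ : ∀ x → (x ∨ 𝟎) ≈ x
  ∨-identityʳ x = trans (∨-cong refl (sym (∧-zeroʳ x))) (∨-absorbs-∧ x 𝟎)

  ∧-identityˡ : ∀ x → (𝟏 ∧ x) ≈ x
  ∧-identityˡ x = trans (∧-comm 𝟏 x) (𝟏-greatest x)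

  modular-cancel-disjoint : ∀ {x y z} → x ≤ y → (z ∧ y) ≈ 𝟎 → ((x ∨ z) ∧ y) ≈ x
  modular-cancel-disjoint {x} {y} {z} x≤y z∧y≈𝟎 = begin
    (x ∨ z) ∧ y ≈⟨ sym (modular x z y x≤y) ⟩
    x ∨ (z ∧ y) ≈⟨ ∨-cong refl z∧y≈𝟎 ⟩
    x ∨ 𝟎       ≈⟨ ∨-identityʳ x ⟩
    x           ∎

  modular-cancel-codisjoint : ∀ {x y z} → x ≤ y → (x ∨ z) ≈ 𝟏 → (x ∨ (z ∧ y)) ≈ y
  modular-cancel-codisjoint {x} {y} {z} x≤y x∨z≈𝟏 = begin
    x ∨ (z ∧ y) ≈⟨ modular x z y x≤y ⟩
    (x ∨ z) ∧ y ≈⟨ ∧-cong x∨z≈𝟏 refl ⟩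
    𝟏 ∧ y       ≈⟨ ∧-identityˡ y ⟩
    y           ∎

  ∧-complement-∨-∧ : ∀ a b {x} → (a ∧ x) ≈ 𝟎 → (a ∧ (x ∨ (a ∧ b))) ≈ (a ∧ b)
  ∧-complement-∨-∧ a b {x} a∧x≈𝟎 = begin
    a ∧ (x ∨ (a ∧ b)) ≈⟨ ∧-comm a _ ⟩
    (x ∨ (a ∧ b)) ∧ a ≈⟨ ∧-cong (∨-comm x _) refl ⟩
    ((a ∧ b) ∨ x) ∧ a ≈⟨ modular-cancel-disjoint (x∧y≤x a b) (trans (∧-comm x a) a∧x≈𝟎) ⟩
    a ∧ b             ∎

module SubsetProperties {c ℓ : Level} (L : ComplementedModularLattice c ℓ) where

  open ComplementedModularLattice L
  open Subsets L
  open ComplementedModularLatticeProperties L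
  open SetoidReasoning setoid

  ⟦⟧-cong : ∀ {x y} → x ≈ y → ⟦ x ⟧ ≐ ⟦ y ⟧
  ⟦⟧-cong x≈y = (λ z z≈x → lift (trans (lower z≈x) x≈y))
              , (λ z z≈y → lift (trans (lower z≈y) (sym x≈y)))

  ∨ˢ-congˡ : ∀ {A B C} → B ≐ C → (A ∨ˢ B) ≐ (A ∨ˢ C)
  ∨ˢ-congˡ (B⊆C , C⊆B) =
      (λ { z (x , y , x∈A , y∈B , z≈) → x , y , x∈A , B⊆C y y∈B , z≈ })
    , (λ { z (x , y , x∈A , y∈C , z≈) → x , y , x∈A , C⊆B y y∈C , z≈ })

  ⁺-resp-≈ : ∀ a {x y} → x ≈ y → x ∈ (a ⁺) → y ∈ (a ⁺)
  ⁺-resp-≈ a x≈y (lift (a∨x≈𝟏 , a∧x≈𝟎)) =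
    lift (trans (∨-cong refl (sym x≈y)) a∨x≈𝟏 , trans (∧-cong refl (sym x≈y)) a∧x≈𝟎)

  ∨-∧-∈⇒ : ∀ a b {x} → x ∈ (a ⁺) → (x ∨ (a ∧ b)) ∈ (a ⇒ b)
  ∨-∧-∈⇒ a b {x} x∈a⁺ = x , a ∧ b , x∈a⁺ , lift refl , lift refl

  ⁺-nonempty : ∀ a → ∃[ x ] x ∈ (a ⁺)
  ⁺-nonempty a = let x , a∨x≈𝟏 , a∧x≈𝟎 = complemented a in x , lift (a∨x≈𝟏 , a∧x≈𝟎)

  ∈⇒-∧ : ∀ a b {z} → z ∈ (a ⇒ b) → (a ∧ z) ≈ (a ∧ b)
  ∈⇒-∧ a b (x , y , lift (_ , a∧x≈𝟎) , lift y≈a∧b , lift z≈x∨y) =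
    trans (∧-cong refl (trans z≈x∨y (∨-cong refl y≈a∧b))) (∧-complement-∨-∧ a b a∧x≈𝟎)

  modus-ponens : ∀ a b → (⟦ a ⟧ ∧ˢ (a ⇒ b)) ≐ ⟦ a ∧ b ⟧
  modus-ponens a b = ⊆ , ⊇
    where
    ⊆ : ∀ z → z ∈ (⟦ a ⟧ ∧ˢ (a ⇒ b)) → z ∈ ⟦ a ∧ b ⟧
    ⊆ z (u , w , lift u≈a , w∈a⇒b , lift z≈u∧w) =
      lift (trans z≈u∧w (trans (∧-cong u≈a refl) (∈⇒-∧ a b w∈a⇒b)))
    ⊇ : ∀ z → z ∈ ⟦ a ∧ b ⟧ → z ∈ (⟦ a ⟧ ∧ˢ (a ⇒ b))
    ⊇ z (lift z≈a∧b) =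
      let x , x∈a⁺ = ⁺-nonempty a
          a∧x≈𝟎 = proj₂ (lower x∈a⁺)
      in a , x ∨ (a ∧ b) , lift refl , ∨-∧-∈⇒ a b x∈a⁺ ,
         lift (trans z≈a∧b (sym (∧-complement-∨-∧ a b a∧x≈𝟎)))

  modus-tollens : ∀ a b → (a ⁺) ≤ˢ (b ⁺) → ((a ⇒ b) ∧ˢ (b ⁺)) ≐ (a ⁺)
  modus-tollens a b a⁺≤b⁺ = ⊆ , ⊇
    where
    cancel : ∀ {x y} → x ∈ (a ⁺) → y ∈ (b ⁺) → ((x ∨ (a ∧ b)) ∧ y) ≈ x
    cancel {x} {y} x∈a⁺ y∈b⁺ =
      modular-cancel-disjoint (a⁺≤b⁺ x y x∈a⁺ y∈b⁺)
        (trans (∧-assoc a b y) (trans (∧-cong refl (proj₂ (lower y∈b⁺))) (∧-zeroʳ a)))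
    ⊆ : ∀ z → z ∈ ((a ⇒ b) ∧ˢ (b ⁺)) → z ∈ (a ⁺)
    ⊆ z (w , y , (x , v , x∈a⁺ , lift v≈a∧b , lift w≈x∨v) , y∈b⁺ , lift z≈w∧y) =
      ⁺-resp-≈ a (sym (begin
        z                 ≈⟨ z≈w∧y ⟩
        w ∧ y             ≈⟨ ∧-cong (trans w≈x∨v (∨-cong refl v≈a∧b)) refl ⟩
        (x ∨ (a ∧ b)) ∧ y ≈⟨ cancel x∈a⁺ y∈b⁺ ⟩
        x                 ∎)) x∈a⁺
    ⊇ : ∀ z → z ∈ (a ⁺) → z ∈ ((a ⇒ b) ∧ˢ (b ⁺))
    ⊇ z z∈a⁺ =
      let y , y∈b⁺ = ⁺-nonempty b
      in z ∨ (a ∧ b) , y , ∨-∧-∈⇒ a b z∈a⁺ , y∈b⁺ , lift (sym (cancel z∈a⁺ y∈b⁺))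

  ⇒-resp-∈⇒ : ∀ a b {x} → x ∈ (a ⇒ b) → (a ⇒ x) ≐ (a ⇒ b)
  ⇒-resp-∈⇒ a b x∈a⇒b = ∨ˢ-congˡ (⟦⟧-cong (∈⇒-∧ a b x∈a⇒b))

  ⇒ˢ-⇒-idem : ∀ a b → (a ⇒ˢ (a ⇒ b)) ≐ (a ⇒ b)
  ⇒ˢ-⇒-idem a b = ∨ˢ-congˡ (modus-ponens a b)

  ⇒-singleton : ∀ a b → (a ⁺) ≤ˢ ⟦ b ⟧ → (a ⇒ b) ≐ ⟦ b ⟧
  ⇒-singleton a b a⁺≤b = ⊆ , ⊇
    where
    cancel : ∀ {x} → x ∈ (a ⁺) → (x ∨ (a ∧ b)) ≈ b
    cancel {x} x∈a⁺ =
      modular-cancel-codisjoint (a⁺≤b x b x∈a⁺ (lift refl))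
        (trans (∨-comm x a) (proj₁ (lower x∈a⁺)))
    ⊆ : ∀ z → z ∈ (a ⇒ b) → z ∈ ⟦ b ⟧
    ⊆ z (x , y , x∈a⁺ , lift y≈a∧b , lift z≈x∨y) =
      lift (trans z≈x∨y (trans (∨-cong refl y≈a∧b) (cancel x∈a⁺)))
    ⊇ : ∀ z → z ∈ ⟦ b ⟧ → z ∈ (a ⇒ b)
    ⊇ z (lift z≈b) =
      let x , x∈a⁺ = ⁺-nonempty a
      in x , a ∧ b , x∈a⁺ , lift refl , lift (trans z≈b (sym (cancel x∈a⁺)))

theorem3p5 : {c ℓ : Level} (L : ComplementedModularLattice c ℓ) → let open ComplementedModularLattice L in let open Subsets L in
    (a b : Carrier) →
    ((⟦ a ⟧ ∧ˢ (a ⇒ b)) ≐ ⟦ a ∧ b ⟧ × (a ∧ b) ≤ b)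
    × ((a ⁺) ≤ˢ (b ⁺) → ((a ⇒ b) ∧ˢ (b ⁺)) ≐ (a ⁺))
    × (∀ x → x ∈ (a ⇒ b) → (a ⇒ x) ≐ (a ⇒ b))
    × ((a ⇒ˢ (a ⇒ b)) ≐ (a ⇒ b))
    × ((a ⁺) ≤ˢ ⟦ b ⟧ → (a ⇒ b) ≐ ⟦ b ⟧)
theorem3p5 L a b =
    (modus-ponens a b , x∧y≤y a b)
  , modus-tollens a b
  , (λ _ → ⇒-resp-∈⇒ a b)
  , ⇒ˢ-⇒-idem a b
  , ⇒-singleton a b
  where
  open ComplementedModularLatticeProperties L
  open SubsetProperties L
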